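{- Let $A$, $B$, $m$, $n$ be positive integers such that $m$ and $n$ are coprime, $A \ge n$ and $B \ge m$. Let $S = \{am+bn : a\in\{0,\ldots,A\},\ b\in\{0,\ldots,B\}\}$ and let $H_o = \{v\in\mathbb{N} : am+bn \ne v \text{ for all } (a,b)\in\mathbb{N}^2\}$ be the set of non-negative integers not representable as a non-negative integer combination of $m$ and $n$. Let $s$ be an integer with $0 \le s \le \tfrac12(Am+Bn)$ and $s \notin H_o$. Then $s \in S$.
   Context: $\mathbb{N}$ denotes the set of non-negative integers. -}

module Defs where

open import Data.Nat using (ℕ; _+_; _*_; _≤_)
open import Data.Product using (Σ; _×_)
open import Relation.Binary.PropositionalEquality using (_≡_; _≢_)

InS : ℕ → ℕ → ℕ → ℕ → ℕ → Set
InS A B m n v = Σ ℕ λ a → Σ ℕ λ b → a ≤ A × b ≤ B × a * m + b * n ≡ v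

InHo : ℕ → ℕ → ℕ → Set
InHo m n v = (a b : ℕ) → a * m + b * n ≢ v

-- Take any representation s = a m + b n. Replacing a by a mod n (and b by b + (a div n) m)
-- keeps a ≤ A since n ≤ A, so the new pair witnesses s ∈ S unless the new b exceeds B,
-- which forces s > B n; symmetrically s ∈ S unless s > A m. Both failing gives
-- 2 s > A m + B n. As ¬ InHo only yields ¬ ¬ (a representation),
-- the witness is recovered from the decidability of membership in S.
module Submission where

open import Defs
open import Data.Nat using (ℕ; suc; _+_; _*_; _≤_; _≥_; _<_; s≤s; s≤s⁻¹; NonZero; >-nonZero; _≤?_; _≟_)
open import Data.Nat.Properties
open import Data.Nat.DivMod using (_/_; _%_; m≡m%n+[m/n]*n; m%n≤n)
open import Data.Nat.Coprimality using (Coprime)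
open import Data.Nat.Tactic.RingSolver using (solve-∀)
open import Data.Product using (∃; _×_; _,_)
open import Data.Sum using (_⊎_; inj₁; inj₂)
open import Relation.Nullary using (¬_; Dec; yes; no; contradiction)
open import Relation.Nullary.Decidable using (map′; decidable-stable)
open import Relation.Binary.PropositionalEquality using (_≡_; trans; cong; subst; module ≡-Reasoning)

InS? : ∀ A B m n s → Dec (InS A B m n s)
InS? A B m n s =
  map′ from to (anyUpTo? (λ a → anyUpTo? (λ b → a * m + b * n ≟ s) (suc B)) (suc A))
  where
  from : (∃ λ a → a < suc A × ∃ λ b → b < suc B × a * m + b * n ≡ s) → InS A B m n s
  from (a , a<1+A , b , b<1+B , eq) = a , b , s≤s⁻¹ a<1+A , s≤s⁻¹ b<1+B , eq
  to : InS A B m n s → ∃ λ a → a < suc A × ∃ λ b → b < suc B × a * m + b * n ≡ s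
  to (a , b , a≤A , b≤B , eq) = a , s≤s a≤A , b , s≤s b≤B , eq

InS-swap : ∀ {A B m n s} → InS B A n m s → InS A B m n s
InS-swap {m = m} {n} (b , a , b≤B , a≤A , eq) = a , b , a≤A , b≤B , trans (+-comm (a * m) (b * n)) eq

trade-multiple : ∀ a q b m n → a * m + (b + q * m) * n ≡ (a + q * n) * m + b * n
trade-multiple = solve-∀

reduce-mod : ∀ m n .{{_ : NonZero n}} a b → a % n * m + (b + a / n * m) * n ≡ a * m + b * n
reduce-mod m n a b = begin
  a % n * m + (b + a / n * m) * n ≡⟨ trade-multiple (a % n) (a / n) b m n ⟩
  (a % n + a / n * n) * m + b * n ≡⟨ cong (λ x → x * m + b * n) (m≡m%n+[m/n]*n a n) ⟨
  a * m + b * n                   ∎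
  where open ≡-Reasoning

InS⊎large : ∀ A B m n .{{_ : NonZero n}} → n ≤ A → ∀ {s} a b → a * m + b * n ≡ s →
  InS A B m n s ⊎ B * n < s
InS⊎large A B m n n≤A a b eq with b + a / n * m ≤? B
... | yes b′≤B = inj₁ (a % n , b + a / n * m , ≤-trans (m%n≤n a n) n≤A , b′≤B ,
  trans (reduce-mod m n a b) eq)
... | no b′≰B = inj₂ (begin-strict
  B * n                           <⟨ *-monoˡ-< n (≰⇒> b′≰B) ⟩
  (b + a / n * m) * n             ≤⟨ m≤n+m _ (a % n * m) ⟩
  a % n * m + (b + a / n * m) * n ≡⟨ trans (reduce-mod m n a b) eq ⟩
  _                               ∎)
  where open ≤-Reasoning

representable⇒InS : ∀ A B m n .{{_ : NonZero m}} .{{_ : NonZero n}} → n ≤ A → m ≤ B →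
  ∀ {s} → 2 * s ≤ A * m + B * n → ∀ a b → a * m + b * n ≡ s → InS A B m n s
representable⇒InS A B m n n≤A m≤B {s} 2s≤ a b eq
  with InS⊎large A B m n n≤A a b eq
     | InS⊎large B A n m m≤B b a (trans (+-comm (b * n) (a * m)) eq)
... | inj₁ inS | _        = inS
... | inj₂ _   | inj₁ inS = InS-swap inS
... | inj₂ Bn< | inj₂ Am< = contradiction (+-mono-< Am< Bn<) (≤⇒≯ (subst (_≤ A * m + B * n) 2s≡s+s 2s≤))
  where
  2s≡s+s : 2 * s ≡ s + s
  2s≡s+s = cong (s +_) (+-identityʳ s)

lemma3 : (A B m n : ℕ) → 0 < A → 0 < B → 0 < m → 0 < n →
    Coprime m n → A ≥ n → B ≥ m →
    (s : ℕ) → 2 * s ≤ A * m + B * n → ¬ InHo m n s →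
    InS A B m n s
lemma3 A B m n _ _ 0<m 0<n _ n≤A m≤B s 2s≤ notInHo =
  decidable-stable (InS? A B m n s) λ notInS →
    notInHo λ a b eq → notInS
      (representable⇒InS A B m n {{>-nonZero 0<m}} {{>-nonZero 0<n}} n≤A m≤B 2s≤ a b eq)
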